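{- Let $X,Y$ be $\mathfrak{Q}$-preordered $\mathfrak{Q}$-subsets and $\phi,\psi\colon X\nrightarrow Y$ be $\mathfrak{Q}$-distributors. Then $$\phi=\psi\iff\phi_\uparrow=\psi_\uparrow\iff\phi^\downarrow=\psi^\downarrow\iff\phi^*=\psi^*\iff\phi^\dagger=\psi^\dagger.$$
   Context: $(\mathfrak{Q},\&,e)$ is a unital quantale (complete lattice with an associative multiplication $\&$ with unit $e$, distributing over arbitrary joins in each variable), assumed non-trivial ($\bot<e$). Implications: $p\& q\le r\iff p\le r/q\iff q\le p\backslash r$. $\mathcal{D}\mathfrak{Q}(p,q)=\{u\in\mathfrak{Q}: (u/p)\& p=u=q\&(q\backslash u)\}$. A $\mathfrak{Q}$-subset is a set $X$ with a map $|\cdot|\colon X\to\mathfrak{Q}$. A $\mathfrak{Q}$-relation $\phi\colon X\nrightarrow Y$ is a map $X\times Y\to\mathfrak{Q}$ with $\phi(x,y)\in\mathcal{D}\mathfrak{Q}(|x|,|y|)$. Composition: $(\psi\circ\phi)(x,z)=\bigvee_{y}(\psi(y,z)/|y|)\&\phi(x,y)$; identity $\mathrm{id}_X(x,x')=|x|$ if $x=x'$, $\bot$ otherwise; pointwise order. $\xi\swarrow\phi$ (for $\phi\colon X\nrightarrow Y$, $\xi\colon X\nrightarrow Z$) is the join of all $\psi'\colon Y\nrightarrow Z$ with $\psi'\circ\phi\le\xi$; $\psi\searrow\xi$ (for $\psi\colon Y\nrightarrow Z$) is the join of all $\phi'\colon X\nrightarrow Y$ with $\psi\circ\phi'\le\xi$.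 $\mathbf{1}_q$ is the singleton $\{*\}$ with $|*|=q$. A $\mathfrak{Q}$-preordered $\mathfrak{Q}$-subset is a $\mathfrak{Q}$-subset $X$ with $1_X^\natural\colon X\nrightarrow X$, $\mathrm{id}_X\le 1_X^\natural$, $1_X^\natural\circ 1_X^\natural\le 1_X^\natural$. A $\mathfrak{Q}$-distributor $\phi\colon X\nrightarrow Y$ is a $\mathfrak{Q}$-relation with $1_Y^\natural\circ\phi\circ 1_X^\natural\le\phi$. $\mathsf{P}X$: all $\mu\colon X\nrightarrow\mathbf{1}_q$ ($q\in\mathfrak{Q}$) with $\mu\circ 1_X^\natural\le\mu$. $\mathsf{P}^\dagger X$: all $\lambda\colon\mathbf{1}_q\nrightarrow X$ with $1_X^\natural\circ\lambda\le\lambda$. For a $\mathfrak{Q}$-distributor $\phi\colon X\nrightarrow Y$: $\phi_\uparrow\colon\mathsf{P}X\to\mathsf{P}^\dagger Y$, $\mu\mapsto\phi\swarrow\mu$; $\phi^\downarrow\colon\mathsf{P}^\dagger Y\to\mathsf{P}X$, $\lambda'\mapsto\lambda'\searrow\phi$; $\phi^*\colon\mathsf{P}Y\to\mathsf{P}X$, $\mu'\mapsto\mu'\circ\phi$; $\phi^\dagger\colon\mathsf{P}^\dagger X\to\mathsf{P}^\dagger Y$, $\lambda\mapsto\phi\circ\lambda$. -}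

module Defs where

open import Level using (Level; suc)
open import Data.Product using (Σ; _×_; proj₁)
open import Data.Empty.Polymorphic using (⊥)
open import Data.Unit.Polymorphic using (⊤)
open import Relation.Binary.PropositionalEquality using (_≡_; _≢_)
open import Function.Bundles using (_⇔_)

record Quantale (c : Level) : Set (suc c) where
  infixl 7 _&_
  infix 4 _≤_
  field
    Carrier   : Set c
    _≤_       : Carrier → Carrier → Set c
    ≤-refl    : ∀ {a} → a ≤ a
    ≤-trans   : ∀ {a b d} → a ≤ b → b ≤ d → a ≤ d
    ≤-antisym : ∀ {a b} → a ≤ b → b ≤ a → a ≡ b
    ⋁         : {I : Set c} → (I → Carrier) → Carrier
    ⋁-ub      : ∀ {I : Set c} (f : I → Carrier) (i : I) → f i ≤ ⋁ f
    ⋁-least   : ∀ {I : Set c} (f : I → Carrier) (a : Carrier) → (∀ i → f i ≤ a) → ⋁ f ≤ a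
    _&_       : Carrier → Carrier → Carrier
    e         : Carrier
    &-assoc   : ∀ a b d → (a & b) & d ≡ a & (b & d)
    &-identityˡ : ∀ a → e & a ≡ a
    &-identityʳ : ∀ a → a & e ≡ a
    &-distribˡ : ∀ a {I : Set c} (f : I → Carrier) → a & ⋁ f ≡ ⋁ (λ i → a & f i)
    &-distribʳ : ∀ a {I : Set c} (f : I → Carrier) → ⋁ f & a ≡ ⋁ (λ i → f i & a)
    nontrivial : ⋁ {⊥} (λ ()) ≢ e

module Theory {c : Level} (Q : Quantale c) where
  open Quantale Q

  ⊥Q : Carrier
  ⊥Q = ⋁ {⊥} (λ ())

  -- implications:  p & q ≤ r  ⇔  p ≤ r / q  ⇔  q ≤ p ⧵ r
  _/_ : Carrier → Carrier → Carrier
  r / q = ⋁ {Σ Carrier (λ p → p & q ≤ r)} proj₁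

  _⧵_ : Carrier → Carrier → Carrier
  p ⧵ r = ⋁ {Σ Carrier (λ q → p & q ≤ r)} proj₁

  DQ : Carrier → Carrier → Carrier → Set c
  DQ p q u = ((u / p) & p ≡ u) × (q & (q ⧵ u) ≡ u)

  record QSubset : Set (suc c) where
    field
      Elt : Set c
      ∣_∣ : Elt → Carrier
  open QSubset public

  𝟏 : Carrier → QSubset
  𝟏 q = record { Elt = ⊤ ; ∣_∣ = λ _ → q }

  -- maps X × Y → 𝔔 (raw), wrapped so that X and Y are inferable
  record Rel (X Y : QSubset) : Set c where
    constructor rel
    field app : Elt X → Elt Y → Carrier
  open Rel public

  IsQRel : {X Y : QSubset} → Rel X Y → Set c
  IsQRel {X} {Y} φ = ∀ x y → DQ (∣ X ∣ x) (∣ Y ∣ y) (app φ x y)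

  infixr 9 _∘_
  _∘_ : {X Y Z : QSubset} → Rel Y Z → Rel X Y → Rel X Z
  _∘_ {X} {Y} {Z} ψ φ = rel (λ x z → ⋁ {Elt Y} (λ y → (app ψ y z / ∣ Y ∣ y) & app φ x y))

  -- identity: |x| if x = x', ⊥ otherwise (written as the join over the proof of x ≡ x')
  idR : (X : QSubset) → Rel X X
  idR X = rel (λ x x' → ⋁ {x ≡ x'} (λ _ → ∣ X ∣ x))

  infix 4 _≤R_ _≐_
  _≤R_ : {X Y : QSubset} → Rel X Y → Rel X Y → Set c
  φ ≤R ψ = ∀ x y → app φ x y ≤ app ψ x y

  _≐_ : {X Y : QSubset} → Rel X Y → Rel X Y → Set c
  φ ≐ ψ = ∀ x y → app φ x y ≡ app ψ x y

  _↙_ : {X Y Z : QSubset} → Rel X Z → Rel X Y → Rel Y Z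
  _↙_ {X} {Y} {Z} ξ φ =
    rel (λ y z → ⋁ {Σ (Rel Y Z) (λ ψ' → IsQRel ψ' × (ψ' ∘ φ ≤R ξ))} (λ s → app (proj₁ s) y z))

  _↘_ : {X Y Z : QSubset} → Rel Y Z → Rel X Z → Rel X Y
  _↘_ {X} {Y} {Z} ψ ξ =
    rel (λ x y → ⋁ {Σ (Rel X Y) (λ φ' → IsQRel φ' × (ψ ∘ φ' ≤R ξ))} (λ s → app (proj₁ s) x y))

  record PreSubset : Set (suc c) where
    field
      sub     : QSubset
      one     : Rel sub sub
      one-rel : IsQRel one
      one-refl  : idR sub ≤R one
      one-trans : one ∘ one ≤R one
  open PreSubset public

  IsDistributor : (X Y : PreSubset) → Rel (sub X) (sub Y) → Set c
  IsDistributor X Y φ = IsQRel φ × (one Y ∘ φ ∘ one X ≤R φ)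

  -- μ ∈ 𝖯X with μ : X ⇸ 𝟏_q
  InP : (X : PreSubset) (q : Carrier) → Rel (sub X) (𝟏 q) → Set c
  InP X q μ = IsQRel μ × (μ ∘ one X ≤R μ)

  -- λ ∈ 𝖯†X with λ : 𝟏_q ⇸ X
  InP† : (X : PreSubset) (q : Carrier) → Rel (𝟏 q) (sub X) → Set c
  InP† X q l = IsQRel l × (one X ∘ l ≤R l)

  -- equality of the induced maps (maps are equal iff they agree on every element of the domain)
  Eq↑ : (X Y : PreSubset) → (φ ψ : Rel (sub X) (sub Y)) → Set c
  Eq↑ X Y φ ψ = ∀ (q : Carrier) (μ : Rel (sub X) (𝟏 q)) → InP X q μ → φ ↙ μ ≐ ψ ↙ μ

  Eq↓ : (X Y : PreSubset) → (φ ψ : Rel (sub X) (sub Y)) → Set c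
  Eq↓ X Y φ ψ = ∀ (q : Carrier) (l : Rel (𝟏 q) (sub Y)) → InP† Y q l → l ↘ φ ≐ l ↘ ψ

  Eq* : (X Y : PreSubset) → (φ ψ : Rel (sub X) (sub Y)) → Set c
  Eq* X Y φ ψ = ∀ (q : Carrier) (μ : Rel (sub Y) (𝟏 q)) → InP Y q μ → μ ∘ φ ≐ μ ∘ ψ

  Eq† : (X Y : PreSubset) → (φ ψ : Rel (sub X) (sub Y)) → Set c
  Eq† X Y φ ψ = ∀ (q : Carrier) (l : Rel (𝟏 q) (sub X)) → InP† X q l → φ ∘ l ≐ ψ ∘ l

-- Each of the four maps is monotone in φ, hence respects φ ≐ ψ. Conversely, evaluated at the
-- representable (co)presheaves 1_X(-, x), 1_Y(y, -), … each of them returns a row or column of φ,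
-- because a distributor absorbs the preorders: 1_Y ∘ φ = φ = φ ∘ 1_X.

module Submission where

open import Defs
open import Level using (Level)
open import Data.Product using (_×_; _,_; Σ; proj₁; proj₂)
open import Data.Unit.Polymorphic using (tt)
open import Function.Bundles using (_⇔_; mk⇔)
open import Function.Properties.Equivalence using () renaming (sym to ⇔-sym; trans to ⇔-trans)
open import Relation.Binary.PropositionalEquality using (_≡_; refl; sym; trans; cong)

⇔-through : ∀ {a b c} {A : Set a} {B : Set b} {C : Set c} → C ⇔ A → C ⇔ B → A ⇔ B
⇔-through C⇔A C⇔B = ⇔-trans (⇔-sym C⇔A) C⇔B

module Distributors {c : Level} (Q : Quantale c) where
  open Quantale Q
  open Theory Q

  ≡⇒≤ : ∀ {a b} → a ≡ b → a ≤ b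
  ≡⇒≤ refl = ≤-refl

  ⋁-mono : {I J : Set c} (f : I → Carrier) (g : J → Carrier) →
           (∀ i → Σ J (λ j → f i ≤ g j)) → ⋁ f ≤ ⋁ g
  ⋁-mono f g h = ⋁-least f (⋁ g) (λ i → ≤-trans (proj₂ (h i)) (⋁-ub g (proj₁ (h i))))

  ⋁-principal : ∀ b → b ≡ ⋁ {Σ Carrier (_≤ b)} proj₁
  ⋁-principal b = ≤-antisym (⋁-ub proj₁ (b , ≤-refl)) (⋁-least proj₁ b proj₂)

  &-monoˡ : ∀ {a b} d → a ≤ b → a & d ≤ b & d
  &-monoˡ {a} {b} d a≤b = ≤-trans (⋁-ub (λ s → proj₁ s & d) (a , a≤b))
    (≡⇒≤ (sym (trans (cong (_& d) (⋁-principal b)) (&-distribʳ d proj₁))))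

  &-monoʳ : ∀ {a b} d → a ≤ b → d & a ≤ d & b
  &-monoʳ {a} {b} d a≤b = ≤-trans (⋁-ub (λ s → d & proj₁ s) (a , a≤b))
    (≡⇒≤ (sym (trans (cong (d &_) (⋁-principal b)) (&-distribˡ d proj₁))))

  /-intro : ∀ {p q r} → p & q ≤ r → p ≤ r / q
  /-intro {p} h = ⋁-ub proj₁ (p , h)

  /-counit : ∀ {r q} → (r / q) & q ≤ r
  /-counit {r} {q} = ≤-trans (≡⇒≤ (&-distribʳ q proj₁)) (⋁-least _ r proj₂)

  /-monoˡ : ∀ {r r' q} → r ≤ r' → r / q ≤ r' / q
  /-monoˡ h = /-intro (≤-trans /-counit h)

  ≤R-antisym : {X Y : QSubset} (φ ψ : Rel X Y) → φ ≤R ψ → ψ ≤R φ → φ ≐ ψ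
  ≤R-antisym φ ψ φ≤ψ ψ≤φ x y = ≤-antisym (φ≤ψ x y) (ψ≤φ x y)

  mono⇒cong : {X Y A B : QSubset} (F : Rel X Y → Rel A B) →
              (∀ φ ψ → φ ≤R ψ → F φ ≤R F ψ) →
              (φ ψ : Rel X Y) → φ ≐ ψ → F φ ≐ F ψ
  mono⇒cong F F-mono φ ψ φ≐ψ = ≤R-antisym (F φ) (F ψ)
    (F-mono φ ψ λ x y → ≡⇒≤ (φ≐ψ x y))
    (F-mono ψ φ λ x y → ≡⇒≤ (sym (φ≐ψ x y)))

  ∘-monoʳ : {X Y Z : QSubset} (ψ : Rel Y Z) (φ φ' : Rel X Y) → φ ≤R φ' → ψ ∘ φ ≤R ψ ∘ φ'
  ∘-monoʳ {Y = Y} ψ φ φ' φ≤φ' x z =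
    ⋁-mono _ _ (λ y → y , &-monoʳ (app ψ y z / ∣ Y ∣ y) (φ≤φ' x y))

  ∘-monoˡ : {X Y Z : QSubset} (φ : Rel X Y) (ψ ψ' : Rel Y Z) → ψ ≤R ψ' → ψ ∘ φ ≤R ψ' ∘ φ
  ∘-monoˡ φ ψ ψ' ψ≤ψ' x z =
    ⋁-mono _ _ (λ y → y , &-monoˡ (app φ x y) (/-monoˡ (ψ≤ψ' y z)))

  ↙-monoˡ : {X Y Z : QSubset} (φ : Rel X Y) (ξ ξ' : Rel X Z) → ξ ≤R ξ' → ξ ↙ φ ≤R ξ' ↙ φ
  ↙-monoˡ φ ξ ξ' ξ≤ξ' y z = ⋁-mono _ _ λ (ψ' , ψ'-rel , ψ'∘φ≤ξ) →
    (ψ' , ψ'-rel , λ x z' → ≤-trans (ψ'∘φ≤ξ x z') (ξ≤ξ' x z')) , ≤-refl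

  ↘-monoʳ : {X Y Z : QSubset} (ψ : Rel Y Z) (ξ ξ' : Rel X Z) → ξ ≤R ξ' → ψ ↘ ξ ≤R ψ ↘ ξ'
  ↘-monoʳ ψ ξ ξ' ξ≤ξ' x y = ⋁-mono _ _ λ (φ' , φ'-rel , ψ∘φ'≤ξ) →
    (φ' , φ'-rel , λ x' z → ≤-trans (ψ∘φ'≤ξ x' z) (ξ≤ξ' x' z)) , ≤-refl

  module _ (X : PreSubset) where

    one-diag : ∀ x → ∣ sub X ∣ x ≤ app (one X) x x
    one-diag x = ≤-trans (⋁-ub {x ≡ x} (λ _ → ∣ sub X ∣ x) refl) (one-refl X x x)

    ≤-one/&ˡ : ∀ x a → a ≤ (app (one X) x x / ∣ sub X ∣ x) & a
    ≤-one/&ˡ x a = ≤-trans (≡⇒≤ (sym (&-identityˡ a)))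
      (&-monoˡ a (/-intro (≤-trans (≡⇒≤ (&-identityˡ _)) (one-diag x))))

    ≤-/&oneʳ : ∀ x u → (u / ∣ sub X ∣ x) & ∣ sub X ∣ x ≡ u → u ≤ (u / ∣ sub X ∣ x) & app (one X) x x
    ≤-/&oneʳ x u u-DQ = ≤-trans (≡⇒≤ (sym u-DQ)) (&-monoʳ _ (one-diag x))

    ≤-one∘ : {W : QSubset} (ξ : Rel W (sub X)) → ξ ≤R one X ∘ ξ
    ≤-one∘ ξ w x = ≤-trans (≤-one/&ˡ x (app ξ w x)) (⋁-ub _ x)

    ≤-∘one : {W : QSubset} (ξ : Rel (sub X) W) → IsQRel ξ → ξ ≤R ξ ∘ one X
    ≤-∘one ξ ξ-rel x w = ≤-trans (≤-/&oneʳ x _ (proj₁ (ξ-rel x w))) (⋁-ub _ x)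

    yoneda : ∀ x → Rel (sub X) (𝟏 (∣ sub X ∣ x))
    yoneda x = rel (λ x' _ → app (one X) x' x)

    yoneda-InP : ∀ x → InP X (∣ sub X ∣ x) (yoneda x)
    yoneda-InP x = (λ x' _ → one-rel X x' x) , (λ x' _ → one-trans X x' x)

    coyoneda : ∀ x → Rel (𝟏 (∣ sub X ∣ x)) (sub X)
    coyoneda x = rel (λ _ x' → app (one X) x x')

    coyoneda-InP† : ∀ x → InP† X (∣ sub X ∣ x) (coyoneda x)
    coyoneda-InP† x = (λ _ x' → one-rel X x x') , (λ _ x' → one-trans X x x')

  module _ (X Y : PreSubset) (φ : Rel (sub X) (sub Y)) (φ-dist : IsDistributor X Y φ) where

    private
      φ-rel : IsQRel φ
      φ-rel = proj₁ φ-dist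

    one∘≤ : one Y ∘ φ ≤R φ
    one∘≤ x y = ≤-trans (∘-monoʳ (one Y) φ (φ ∘ one X) (≤-∘one X φ φ-rel) x y) (proj₂ φ-dist x y)

    ∘one≤ : φ ∘ one X ≤R φ
    ∘one≤ x y = ≤-trans (≤-one∘ Y (φ ∘ one X) x y) (proj₂ φ-dist x y)

    row : ∀ x → Rel (𝟏 (∣ sub X ∣ x)) (sub Y)
    row x = rel (λ _ y → app φ x y)

    col : ∀ y → Rel (sub X) (𝟏 (∣ sub Y ∣ y))
    col y = rel (λ x _ → app φ x y)

    yoneda∘≐col : ∀ y → yoneda Y y ∘ φ ≐ col y
    yoneda∘≐col y x _ = ≤-antisym (one∘≤ x y) (≤-one∘ Y φ x y)

    ∘coyoneda≐row : ∀ x → φ ∘ coyoneda X x ≐ row x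
    ∘coyoneda≐row x _ y = ≤-antisym (∘one≤ x y) (≤-∘one X φ φ-rel x y)

    ↙yoneda≐row : ∀ x → φ ↙ yoneda X x ≐ row x
    ↙yoneda≐row x _ y = ≤-antisym
      (⋁-least _ _ λ (ψ' , ψ'-rel , ψ'∘yoneda≤φ) →
        ≤-trans (≤-/&oneʳ X x _ (proj₁ (ψ'-rel tt y))) (≤-trans (⋁-ub _ tt) (ψ'∘yoneda≤φ x y)))
      (⋁-ub _ (row x , (λ _ y' → φ-rel x y') ,
        λ x' y' → ≤-trans (⋁-least _ _ λ _ → ⋁-ub _ x) (∘one≤ x' y')))

    coyoneda↘≐col : ∀ y → coyoneda Y y ↘ φ ≐ col y
    coyoneda↘≐col y x _ = ≤-antisym
      (⋁-least _ _ λ (φ' , _ , coyoneda∘φ'≤φ) →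
        ≤-trans (≤-one/&ˡ Y y _) (≤-trans (⋁-ub _ tt) (coyoneda∘φ'≤φ x y)))
      (⋁-ub _ (col y , (λ x' _ → φ-rel x' y) ,
        λ x' y' → ≤-trans (⋁-least _ _ λ _ → ⋁-ub _ y) (one∘≤ x' y')))

  module _ (X Y : PreSubset) (φ ψ : Rel (sub X) (sub Y))
           (φ-dist : IsDistributor X Y φ) (ψ-dist : IsDistributor X Y ψ) where

    ≐⇔Eq↑ : (φ ≐ ψ) ⇔ Eq↑ X Y φ ψ
    ≐⇔Eq↑ = mk⇔
      (λ φ≐ψ _ μ _ → mono⇒cong (_↙ μ) (↙-monoˡ μ) φ ψ φ≐ψ)
      (λ eq x y → trans (sym (↙yoneda≐row X Y φ φ-dist x tt y))
        (trans (eq _ (yoneda X x) (yoneda-InP X x) tt y) (↙yoneda≐row X Y ψ ψ-dist x tt y)))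

    ≐⇔Eq↓ : (φ ≐ ψ) ⇔ Eq↓ X Y φ ψ
    ≐⇔Eq↓ = mk⇔
      (λ φ≐ψ _ l _ → mono⇒cong (l ↘_) (↘-monoʳ l) φ ψ φ≐ψ)
      (λ eq x y → trans (sym (coyoneda↘≐col X Y φ φ-dist y x tt))
        (trans (eq _ (coyoneda Y y) (coyoneda-InP† Y y) x tt) (coyoneda↘≐col X Y ψ ψ-dist y x tt)))

    ≐⇔Eq* : (φ ≐ ψ) ⇔ Eq* X Y φ ψ
    ≐⇔Eq* = mk⇔
      (λ φ≐ψ _ μ _ → mono⇒cong (μ ∘_) (∘-monoʳ μ) φ ψ φ≐ψ)
      (λ eq x y → trans (sym (yoneda∘≐col X Y φ φ-dist y x tt))
        (trans (eq _ (yoneda Y y) (yoneda-InP Y y) x tt) (yoneda∘≐col X Y ψ ψ-dist y x tt)))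

    ≐⇔Eq† : (φ ≐ ψ) ⇔ Eq† X Y φ ψ
    ≐⇔Eq† = mk⇔
      (λ φ≐ψ _ l _ → mono⇒cong (_∘ l) (∘-monoˡ l) φ ψ φ≐ψ)
      (λ eq x y → trans (sym (∘coyoneda≐row X Y φ φ-dist x tt y))
        (trans (eq _ (coyoneda X x) (coyoneda-InP† X x) tt y) (∘coyoneda≐row X Y ψ ψ-dist x tt y)))

proposition4p21 : ∀ {c : Level} (Q : Quantale c) → let open Theory Q in
    (X Y : PreSubset) (φ ψ : Rel (sub X) (sub Y)) →
    IsDistributor X Y φ → IsDistributor X Y ψ →
    ((φ ≐ ψ) ⇔ Eq↑ X Y φ ψ) × (Eq↑ X Y φ ψ ⇔ Eq↓ X Y φ ψ) ×
    (Eq↓ X Y φ ψ ⇔ Eq* X Y φ ψ) × (Eq* X Y φ ψ ⇔ Eq† X Y φ ψ)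
proposition4p21 Q X Y φ ψ φ-dist ψ-dist =
  ↑ , ⇔-through ↑ ↓ , ⇔-through ↓ * , ⇔-through * †
  where
  open Theory Q
  open Distributors Q
  ↑ : (φ ≐ ψ) ⇔ Eq↑ X Y φ ψ
  ↑ = ≐⇔Eq↑ X Y φ ψ φ-dist ψ-dist
  ↓ : (φ ≐ ψ) ⇔ Eq↓ X Y φ ψ
  ↓ = ≐⇔Eq↓ X Y φ ψ φ-dist ψ-dist
  * : (φ ≐ ψ) ⇔ Eq* X Y φ ψ
  * = ≐⇔Eq* X Y φ ψ φ-dist ψ-dist
  † : (φ ≐ ψ) ⇔ Eq† X Y φ ψ
  † = ≐⇔Eq† X Y φ ψ φ-dist ψ-dist
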